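{- Let $G$ be a finite simple graph of order $n\geq 4$ and $u\in V(G)$. Let $H=G-u$ be the graph obtained by deleting $u$ and its incident edges. If $H$ is connected and $\gamma_{\rm ri2}(H)=|V(H)|-1$, then $G$ has a 2RiDF $f$ such that $f(u)=1$ and $f(v)=0$ for some $v\in V(H)$.
   Context: A 2RiDF of a graph $G$ is a function $f: V(G)\to\{0,1,2\}$ such that for each $i\in\{1,2\}$ the set $\{v:f(v)=i\}$ is independent and every vertex $v$ with $f(v)=0$ has a neighbor $u$ with $f(u)=i$; its weight is the number of vertices with nonzero value, and $\gamma_{\rm ri2}(G)$ is the minimum weight of a 2RiDF of $G$. -}

module Defs where

open import Data.Nat using (ℕ; suc; _∸_; _≥_)
open import Data.Fin using (Fin; punchIn)
import Data.Fin
open import Data.Bool using (Bool; true; false)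
open import Data.Product using (Σ; ∃; _×_; _,_)
open import Data.List using (List; []; _∷_; length; filter)
open import Data.List.Relation.Unary.Any using (Any)
open import Data.Fin.Properties using (_≟_)
open import Relation.Nullary using (¬?)
open import Relation.Binary.PropositionalEquality using (_≡_; _≢_)
open import Relation.Nullary using (¬_)
open import Relation.Nullary.Decidable using (does)
open import Data.List using (allFin)

record Graph (n : ℕ) : Set where
  field
    Adj    : Fin n → Fin n → Bool
    sym    : ∀ x y → Adj x y ≡ Adj y x
    irrefl : ∀ x → Adj x x ≡ false
open Graph public

E : ∀ {n} → Graph n → Fin n → Fin n → Set
E G x y = Adj G x y ≡ true

-- G - u : vertices of the result are Fin m, mapped to Fin (suc m) ∖ {u} by punchIn u
deleteVertex : ∀ {m} → Graph (suc m) → Fin (suc m) → Graph m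
deleteVertex G u = record
  { Adj = λ x y → Adj G (punchIn u x) (punchIn u y)
  ; sym = λ x y → sym G (punchIn u x) (punchIn u y)
  ; irrefl = λ x → irrefl G (punchIn u x) }

data Reach {n} (G : Graph n) : Fin n → Fin n → Set where
  here : ∀ {x} → Reach G x x
  step : ∀ {x y z} → E G x y → Reach G y z → Reach G x z

Connected : ∀ {n} → Graph n → Set
Connected {n} G = ∀ (x y : Fin n) → Reach G x y

Label : Set
Label = Fin 3

record Is2RiDF {n} (G : Graph n) (f : Fin n → Label) : Set where
  field
    indep     : ∀ (i : Label) → i ≢ Data.Fin.zero →
                ∀ x y → f x ≡ i → f y ≡ i → ¬ E G x y
    dominates : ∀ (i : Label) → i ≢ Data.Fin.zero →
                ∀ x → f x ≡ Data.Fin.zero → ∃ λ y → E G x y × f y ≡ i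
open Is2RiDF public

weight : ∀ {n} → (Fin n → Label) → ℕ
weight f = length (filter (λ x → ¬? (f x ≟ Data.Fin.zero)) (allFin _))

γri2≡ : ∀ {n} → Graph n → ℕ → Set
γri2≡ {n} G k =
  (Σ (Fin n → Label) λ f → Is2RiDF G f × weight f ≡ k) ×
  (∀ (f : Fin n → Label) → Is2RiDF G f → weight f ≥ k)

-- A 2RiDF can be built greedily: scanning the vertices, give each unlabelled
-- vertex 1 if it has no neighbour labelled 1, else 2 if it has no neighbour
-- labelled 2, else 0. This preserves independence of the 1s and of the 2s and
-- the domination of every 0, so it extends any partial labelling with these
-- properties to a 2RiDF. It therefore suffices to seed a partial labelling with
-- u ↦ 1 and some v ∈ V(H) ↦ 0. If u has a neighbour x in H, take a neighbour z
-- of x in H and label u, x, z by 1, 0, 2. Otherwise take a vertex x of H with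
-- two distinct neighbours y, z (it exists as H is connected with ≥ 3 vertices)
-- and label u, y, x, z by 1, 1, 0, 2.
module Submission where

open import Defs hiding (sym)
open import Data.Bool using (true)
open import Data.Bool.Properties using () renaming (_≟_ to _≟ᴮ_)
open import Data.Empty using (⊥-elim)
open import Data.Fin using (Fin; zero; suc; punchIn)
import Data.Fin
open import Data.Fin.Properties using (any?; punchInᵢ≢i; punchIn-injective) renaming (_≟_ to _≟ᶠ_)
open import Data.List using ([]; _∷_; allFin)
open import Data.List.Membership.Propositional using (_∈_)
open import Data.List.Membership.Propositional.Properties using (∈-allFin)
open import Data.List.Relation.Unary.Any using (here; there)
open import Data.Maybe using (Maybe; just; nothing)
open import Data.Maybe.Properties using (just-injective) renaming (≡-dec to ≡-decᴹ)
open import Data.Nat using (ℕ; suc; _≥_; _∸_; s≤s; z≤n)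
open import Data.Product using (Σ; ∃; ∃-syntax; _×_; _,_; proj₁; proj₂)
open import Data.Sum using (_⊎_; inj₁; inj₂; [_,_])
open import Relation.Binary.PropositionalEquality using (_≡_; _≢_; refl; sym; trans; cong; ≢-sym)
open import Relation.Nullary using (¬_; Dec; yes; no)
open import Relation.Nullary.Decidable using (_×-dec_; ¬?)

one two : Label
one = suc zero
two = suc (suc zero)

nonzero-elim : ∀ {ℓ} {P : Label → Set ℓ} → P one → P two → ∀ i → i ≢ zero → P i
nonzero-elim p₁ p₂ zero             i≢0 = ⊥-elim (i≢0 refl)
nonzero-elim p₁ p₂ (suc zero)       _ = p₁
nonzero-elim p₁ p₂ (suc (suc zero)) _ = p₂

module _ {n : ℕ} (G : Graph n) where

  E-sym : ∀ {x y} → E G x y → E G y x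
  E-sym {x} {y} e = trans (Graph.sym G y x) e

  E⇒≢ : ∀ {x y} → E G x y → x ≢ y
  E⇒≢ {x} e refl with trans (sym (irrefl G x)) e
  ... | ()

  Reach-closed : (P : Fin n → Set) → (∀ {x y} → P x → E G x y → P y) →
                 ∀ {s t} → P s → Reach G s t → P t
  Reach-closed P closed Ps here       = Ps
  Reach-closed P closed Ps (step e r) = Reach-closed P closed (closed Ps e) r

  Reach⇒neighbour : ∀ {x y} → Reach G x y → x ≢ y → ∃ (E G x)
  Reach⇒neighbour here       x≢x = ⊥-elim (x≢x refl)
  Reach⇒neighbour (step e _) _   = _ , e

neighbour : ∀ {k} (G : Graph (suc (suc k))) → Connected G → ∀ x → ∃ (E G x)
neighbour G connected x =
  Reach⇒neighbour G (connected x (punchIn x zero)) (≢-sym (punchInᵢ≢i x zero))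

∃-≢₀-≢ : ∀ {k} (b : Fin (suc (suc (suc k)))) → ∃ λ t → t ≢ zero × t ≢ b
∃-≢₀-≢ zero          = suc zero , (λ ()) , (λ ())
∃-≢₀-≢ (suc zero)    = suc (suc zero) , (λ ()) , (λ ())
∃-≢₀-≢ (suc (suc _)) = suc zero , (λ ()) , (λ ())

connected⇒∃-two-neighbours : ∀ {k} (G : Graph (suc (suc (suc k)))) → Connected G →
                             ∃ λ x → ∃ λ y → ∃ λ z → E G x y × E G x z × y ≢ z
connected⇒∃-two-neighbours {k} G connected
  with neighbour G connected zero
... | b , 0~b with any? (λ w → (Adj G zero w ≟ᴮ true) ×-dec ¬? (w ≟ᶠ b))
...   | yes (w , 0~w , w≢b) = zero , b , w , 0~b , 0~w , ≢-sym w≢b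
...   | no ¬other₀ with any? (λ w → (Adj G b w ≟ᴮ true) ×-dec ¬? (w ≟ᶠ zero))
...     | yes (w , b~w , w≢0) = b , zero , w , E-sym G 0~b , b~w , ≢-sym w≢0
...     | no ¬otherᵇ with ∃-≢₀-≢ b
...       | t , t≢0 , t≢b = ⊥-elim ([ t≢0 , t≢b ] (Reach-closed G OnEdge closed (inj₁ refl) (connected zero t)))
  where
  OnEdge : Fin (suc (suc (suc k))) → Set
  OnEdge w = w ≡ zero ⊎ w ≡ b
  closed : ∀ {x y} → OnEdge x → E G x y → OnEdge y
  closed {y = y} (inj₁ refl) x~y with y ≟ᶠ b
  ... | yes y≡b = inj₂ y≡b
  ... | no  y≢b = ⊥-elim (¬other₀ (y , x~y , y≢b))
  closed {y = y} (inj₂ refl) x~y with y ≟ᶠ zero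
  ... | yes y≡0 = inj₁ y≡0
  ... | no  y≢0 = ⊥-elim (¬otherᵇ (y , x~y , y≢0))

Partial : ℕ → Set
Partial n = Fin n → Maybe Label

∅ : ∀ {n} → Partial n
∅ _ = nothing

_[_]≔_ : ∀ {n} → Partial n → Fin n → Label → Partial n
(p [ v ]≔ c) x with x ≟ᶠ v
... | yes _ = just c
... | no  _ = p x

_⊑_ : ∀ {n} → Partial n → Partial n → Set
p ⊑ q = ∀ x a → p x ≡ just a → q x ≡ just a

⊑-refl : ∀ {n} {p : Partial n} → p ⊑ p
⊑-refl _ _ px = px

⊑-trans : ∀ {n} {p q r : Partial n} → p ⊑ q → q ⊑ r → p ⊑ r
⊑-trans p⊑q q⊑r x a px = q⊑r x a (p⊑q x a px)

Labelled : ∀ {n} → Partial n → Fin n → Set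
Labelled p v = ∃ λ a → p v ≡ just a

module _ {n : ℕ} (p : Partial n) where

  []≔-updates : ∀ v c → (p [ v ]≔ c) v ≡ just c
  []≔-updates v c with v ≟ᶠ v
  ... | yes _   = refl
  ... | no v≢v = ⊥-elim (v≢v refl)

  []≔-unchanged : ∀ {v x} c → x ≢ v → (p [ v ]≔ c) x ≡ p x
  []≔-unchanged {v} {x} c x≢v with x ≟ᶠ v
  ... | yes x≡v = ⊥-elim (x≢v x≡v)
  ... | no  _   = refl

  []≔-just⁻¹ : ∀ v c x {a} → (p [ v ]≔ c) x ≡ just a → (x ≡ v × c ≡ a) ⊎ p x ≡ just a
  []≔-just⁻¹ v c x eq with x ≟ᶠ v
  ... | yes x≡v = inj₁ (x≡v , just-injective eq)
  ... | no  _   = inj₂ eq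

  []≔-⊒ : ∀ {v} c → p v ≡ nothing → p ⊑ (p [ v ]≔ c)
  []≔-⊒ {v} c pv≡nothing x a px = trans ([]≔-unchanged c x≢v) px
    where
    x≢v : x ≢ v
    x≢v refl with trans (sym pv≡nothing) px
    ... | ()

module _ {n : ℕ} (G : Graph n) where

  HasNeighbour : Partial n → Fin n → Label → Set
  HasNeighbour p x i = ∃ λ y → E G x y × p y ≡ just i

  hasNeighbour? : ∀ p x i → Dec (HasNeighbour p x i)
  hasNeighbour? p x i = any? λ y → (Adj G x y ≟ᴮ true) ×-dec ≡-decᴹ _≟ᶠ_ (p y) (just i)

  HasNeighbour-mono : ∀ {p q x i} → p ⊑ q → HasNeighbour p x i → HasNeighbour q x i
  HasNeighbour-mono p⊑q (y , e , py) = y , e , p⊑q y _ py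

  ¬HasNeighbour-∅ : ∀ {x i} → ¬ HasNeighbour ∅ x i
  ¬HasNeighbour-∅ (_ , _ , ())

  ¬HasNeighbour-[]≔ : ∀ {p x i} v c → c ≢ i → ¬ HasNeighbour p x i → ¬ HasNeighbour (p [ v ]≔ c) x i
  ¬HasNeighbour-[]≔ {p} v c c≢i ¬N (y , e , py) with []≔-just⁻¹ p v c y py
  ... | inj₁ (_ , c≡i) = c≢i c≡i
  ... | inj₂ py′       = ¬N (y , e , py′)

  record IsPartial2RiDF (p : Partial n) : Set where
    field
      indep     : ∀ i → i ≢ zero → ∀ x y → p x ≡ just i → p y ≡ just i → ¬ E G x y
      dominates : ∀ i → i ≢ zero → ∀ x → p x ≡ just zero → HasNeighbour p x i
  open IsPartial2RiDF

  ∅-isPartial2RiDF : IsPartial2RiDF ∅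
  ∅-isPartial2RiDF = record { indep = λ _ _ _ _ () ; dominates = λ _ _ _ () }

  []≔-nonzero : ∀ {p v c} → IsPartial2RiDF p → p v ≡ nothing → c ≢ zero →
                ¬ HasNeighbour p v c → IsPartial2RiDF (p [ v ]≔ c)
  []≔-nonzero {p} {v} {c} P pv c≢0 ¬N = record { indep = indep′ ; dominates = dominates′ }
    where
    indep′ : ∀ i → i ≢ zero → ∀ x y → (p [ v ]≔ c) x ≡ just i → (p [ v ]≔ c) y ≡ just i → ¬ E G x y
    indep′ i i≢0 x y px py e with []≔-just⁻¹ p v c x px | []≔-just⁻¹ p v c y py
    ... | inj₁ (refl , _)    | inj₁ (refl , _)    = E⇒≢ G e refl
    ... | inj₁ (refl , refl) | inj₂ py′           = ¬N (y , e , py′)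
    ... | inj₂ px′           | inj₁ (refl , refl) = ¬N (x , E-sym G e , px′)
    ... | inj₂ px′           | inj₂ py′           = indep P i i≢0 x y px′ py′ e
    dominates′ : ∀ i → i ≢ zero → ∀ x → (p [ v ]≔ c) x ≡ just zero → HasNeighbour (p [ v ]≔ c) x i
    dominates′ i i≢0 x px with []≔-just⁻¹ p v c x px
    ... | inj₁ (_ , c≡0) = ⊥-elim (c≢0 c≡0)
    ... | inj₂ px′       = HasNeighbour-mono ([]≔-⊒ p c pv) (dominates P i i≢0 x px′)

  []≔-zero : ∀ {p v} → IsPartial2RiDF p → p v ≡ nothing →
             HasNeighbour p v one → HasNeighbour p v two → IsPartial2RiDF (p [ v ]≔ zero)
  []≔-zero {p} {v} P pv N₁ N₂ = record { indep = indep′ ; dominates = dominates′ }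
    where
    indep′ : ∀ i → i ≢ zero → ∀ x y → (p [ v ]≔ zero) x ≡ just i → (p [ v ]≔ zero) y ≡ just i → ¬ E G x y
    indep′ i i≢0 x y px py with []≔-just⁻¹ p v zero x px | []≔-just⁻¹ p v zero y py
    ... | inj₁ (_ , 0≡i) | _              = ⊥-elim (i≢0 (sym 0≡i))
    ... | inj₂ _         | inj₁ (_ , 0≡i) = ⊥-elim (i≢0 (sym 0≡i))
    ... | inj₂ px′       | inj₂ py′       = indep P i i≢0 x y px′ py′
    dominates′ : ∀ i → i ≢ zero → ∀ x → (p [ v ]≔ zero) x ≡ just zero → HasNeighbour (p [ v ]≔ zero) x i
    dominates′ i i≢0 x px with []≔-just⁻¹ p v zero x px
    ... | inj₁ (refl , _) = HasNeighbour-mono ([]≔-⊒ p zero pv) (nonzero-elim {P = HasNeighbour p v} N₁ N₂ i i≢0)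
    ... | inj₂ px′        = HasNeighbour-mono ([]≔-⊒ p zero pv) (dominates P i i≢0 x px′)

  Extension : Partial n → Set
  Extension p = ∃[ q ] IsPartial2RiDF q × p ⊑ q

  extendAt : ∀ {p} → IsPartial2RiDF p → ∀ v → Σ (Extension p) λ (q , _) → Labelled q v
  extendAt {p} P v with p v in pv
  ... | just a  = (p , P , ⊑-refl) , a , pv
  ... | nothing with hasNeighbour? p v one
  ...   | no ¬N₁ = (p [ v ]≔ one , []≔-nonzero P pv (λ ()) ¬N₁ , []≔-⊒ p one pv) , one , []≔-updates p v one
  ...   | yes N₁ with hasNeighbour? p v two
  ...     | no ¬N₂ = (p [ v ]≔ two , []≔-nonzero P pv (λ ()) ¬N₂ , []≔-⊒ p two pv) , two , []≔-updates p v two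
  ...     | yes N₂ = (p [ v ]≔ zero , []≔-zero P pv N₁ N₂ , []≔-⊒ p zero pv) , zero , []≔-updates p v zero

  extendOn : ∀ {p} → IsPartial2RiDF p → ∀ vs →
             Σ (Extension p) λ (q , _) → ∀ v → v ∈ vs → Labelled q v
  extendOn P []       = (_ , P , ⊑-refl) , λ _ ()
  extendOn P (v ∷ vs) with extendAt P v
  ... | (q , Q , p⊑q) , a , qv with extendOn Q vs
  ...   | (r , R , q⊑r) , total = (r , R , ⊑-trans p⊑q q⊑r) , labelled
    where
    labelled : ∀ w → w ∈ v ∷ vs → Labelled r w
    labelled w (here refl)   = a , q⊑r v a qv
    labelled w (there w∈vs) = total w w∈vs

  total⇒Is2RiDF : ∀ {q f} → IsPartial2RiDF q → (∀ x → q x ≡ just (f x)) → Is2RiDF G f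
  total⇒Is2RiDF {q} {f} Q q≡f = record { indep = indep′ ; dominates = dominates′ }
    where
    indep′ : ∀ i → i ≢ zero → ∀ x y → f x ≡ i → f y ≡ i → ¬ E G x y
    indep′ i i≢0 x y fx fy = indep Q i i≢0 x y (trans (q≡f x) (cong just fx)) (trans (q≡f y) (cong just fy))
    dominates′ : ∀ i → i ≢ zero → ∀ x → f x ≡ zero → ∃ λ y → E G x y × f y ≡ i
    dominates′ i i≢0 x fx with dominates Q i i≢0 x (trans (q≡f x) (cong just fx))
    ... | y , e , qy = y , e , just-injective (trans (sym (q≡f y)) qy)

  extend : ∀ {p} → IsPartial2RiDF p → ∃[ f ] Is2RiDF G f × p ⊑ (λ x → just (f x))
  extend P with extendOn P (allFin n)
  ... | (q , Q , p⊑q) , total = f , total⇒Is2RiDF Q q≡f , λ x a px → trans (sym (q≡f x)) (p⊑q x a px)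
    where
    f : Fin n → Label
    f x = proj₁ (total x (∈-allFin x))
    q≡f : ∀ x → q x ≡ just (f x)
    q≡f x = proj₂ (total x (∈-allFin x))

  Seed : Fin n → Fin n → Set
  Seed u x = ∃[ p ] IsPartial2RiDF p × p u ≡ just one × p x ≡ just zero

  cherry-seed : ∀ {u x z} → u ≢ z → E G u x → E G x z → Seed u x
  cherry-seed {u} {x} {z} u≢z u~x x~z = p₃ , P₃ , p₃u , []≔-updates p₂ x zero
    where
    p₁ p₂ p₃ : Partial n
    p₁ = ∅ [ u ]≔ one
    p₂ = p₁ [ z ]≔ two
    p₃ = p₂ [ x ]≔ zero
    u≢x : u ≢ x
    u≢x = E⇒≢ G u~x
    x≢z : x ≢ z
    x≢z = E⇒≢ G x~z
    p₂u : p₂ u ≡ just one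
    p₂u = trans ([]≔-unchanged p₁ two u≢z) ([]≔-updates ∅ u one)
    p₃u : p₃ u ≡ just one
    p₃u = trans ([]≔-unchanged p₂ zero u≢x) p₂u
    P₁ : IsPartial2RiDF p₁
    P₁ = []≔-nonzero ∅-isPartial2RiDF refl (λ ()) ¬HasNeighbour-∅
    P₂ : IsPartial2RiDF p₂
    P₂ = []≔-nonzero P₁ ([]≔-unchanged ∅ one (≢-sym u≢z)) (λ ())
           (¬HasNeighbour-[]≔ u one (λ ()) ¬HasNeighbour-∅)
    P₃ : IsPartial2RiDF p₃
    P₃ = []≔-zero P₂ (trans ([]≔-unchanged p₁ two x≢z) ([]≔-unchanged ∅ one (≢-sym u≢x)))
           (u , E-sym G u~x , p₂u) (z , x~z , []≔-updates p₁ z two)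

  isolated-cherry-seed : ∀ {u x y z} → u ≢ x → u ≢ y → u ≢ z → ¬ E G u y →
                         E G x y → E G x z → y ≢ z → Seed u x
  isolated-cherry-seed {u} {x} {y} {z} u≢x u≢y u≢z u≁y x~y x~z y≢z =
    p₄ , P₄ , p₄u , []≔-updates p₃ x zero
    where
    p₁ p₂ p₃ p₄ : Partial n
    p₁ = ∅ [ u ]≔ one
    p₂ = p₁ [ y ]≔ one
    p₃ = p₂ [ z ]≔ two
    p₄ = p₃ [ x ]≔ zero
    x≢y : x ≢ y
    x≢y = E⇒≢ G x~y
    x≢z : x ≢ z
    x≢z = E⇒≢ G x~z
    p₄u : p₄ u ≡ just one
    p₄u = trans ([]≔-unchanged p₃ zero u≢x) (trans ([]≔-unchanged p₂ two u≢z)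
            (trans ([]≔-unchanged p₁ one u≢y) ([]≔-updates ∅ u one)))
    y≁one : ¬ HasNeighbour p₁ y one
    y≁one (w , y~w , p₁w) with []≔-just⁻¹ ∅ u one w p₁w
    ... | inj₁ (refl , _) = u≁y (E-sym G y~w)
    ... | inj₂ ()
    P₁ : IsPartial2RiDF p₁
    P₁ = []≔-nonzero ∅-isPartial2RiDF refl (λ ()) ¬HasNeighbour-∅
    P₂ : IsPartial2RiDF p₂
    P₂ = []≔-nonzero P₁ ([]≔-unchanged ∅ one (≢-sym u≢y)) (λ ()) y≁one
    P₃ : IsPartial2RiDF p₃
    P₃ = []≔-nonzero P₂ (trans ([]≔-unchanged p₁ one (≢-sym y≢z)) ([]≔-unchanged ∅ one (≢-sym u≢z))) (λ ())
           (¬HasNeighbour-[]≔ y one (λ ()) (¬HasNeighbour-[]≔ u one (λ ()) ¬HasNeighbour-∅))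
    P₄ : IsPartial2RiDF p₄
    P₄ = []≔-zero P₃
           (trans ([]≔-unchanged p₂ two x≢z)
             (trans ([]≔-unchanged p₁ one x≢y) ([]≔-unchanged ∅ one (≢-sym u≢x))))
           (y , x~y , trans ([]≔-unchanged p₂ two y≢z) ([]≔-updates p₁ y one))
           (z , x~z , []≔-updates p₂ z two)

lemma8 : (m : ℕ) → suc m ≥ 4 → (G : Graph (suc m)) → (u : Fin (suc m)) →
    Connected (deleteVertex G u) → γri2≡ (deleteVertex G u) (m ∸ 1) →
    Σ (Fin (suc m) → Label) λ f → Is2RiDF G f × f u ≡ Data.Fin.suc Data.Fin.zero ×
      ∃ λ (v : Fin m) → f (punchIn u v) ≡ Data.Fin.zero
lemma8 (suc (suc (suc k))) (s≤s (s≤s (s≤s (s≤s z≤n)))) G u H-connected _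
  with seed (any? (λ x → Adj G u (punchIn u x) ≟ᴮ true))
  where
  H : Graph (suc (suc (suc k)))
  H = deleteVertex G u
  seed : Dec (∃ λ x → E G u (punchIn u x)) → ∃ λ x → Seed G u (punchIn u x)
  seed (yes (x , u~x)) with neighbour H H-connected x
  ... | z , x~z = x , cherry-seed G (≢-sym (punchInᵢ≢i u z)) u~x x~z
  seed (no u≁H) with connected⇒∃-two-neighbours H H-connected
  ... | x , y , z , x~y , x~z , y≢z =
    x , isolated-cherry-seed G (≢-sym (punchInᵢ≢i u x)) (≢-sym (punchInᵢ≢i u y))
          (≢-sym (punchInᵢ≢i u z)) (λ u~y → u≁H (y , u~y)) x~y x~z
          (λ y≡z → y≢z (punchIn-injective u y z y≡z))
... | x , p , P , pu≡1 , px≡0 with extend G P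
... | f , F , p⊑f = f , F , just-injective (p⊑f u one pu≡1) , x , just-injective (p⊑f (punchIn u x) zero px≡0)
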